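{- Let $G$ be a graph on $n$ vertices with no isolated vertices. Then $\mathrm{ISO}(G)\ge \frac{n-2}{4}$.
   Context: For a graph $G$, $\mathrm{ISO}(G)$ is the largest integer $s$ such that $G$ contains a pair of edge-disjoint isomorphic subgraphs with $s$ edges each. -}

module Defs where

open import Data.Bool using (Bool; true; false; _∧_; if_then_else_)
open import Data.Nat using (ℕ; _+_; _*_; _∸_; _≤_)
open import Data.Fin using (Fin; _<?_)
open import Data.List using (List; map; allFin)
open import Data.Nat.ListAction using (sum)
open import Data.Product using (Σ; ∃; ∃-syntax; _×_)
open import Relation.Nullary.Decidable using (⌊_⌋)
open import Relation.Binary.PropositionalEquality using (_≡_)
open import Function.Bundles using (_↔_; Inverse)

record Graph (n : ℕ) : Set where
  field
    Adj   : Fin n → Fin n → Bool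
    sym   : ∀ i j → Adj i j ≡ Adj j i
    irrefl : ∀ i → Adj i i ≡ false
open Graph public

NoIsolated : ∀ {n} → Graph n → Set
NoIsolated {n} G = ∀ (v : Fin n) → ∃[ u ] Adj G v u ≡ true

record EdgeSet {n : ℕ} (G : Graph n) : Set where
  field
    E      : Fin n → Fin n → Bool
    E-sym  : ∀ i j → E i j ≡ E j i
    E-sub  : ∀ i j → E i j ≡ true → Adj G i j ≡ true
open EdgeSet public

edgeCount : ∀ {n} → (Fin n → Fin n → Bool) → ℕ
edgeCount {n} E =
  sum (map (λ i → sum (map (λ j → if ⌊ i <? j ⌋ ∧ E i j then 1 else 0)
                           (allFin n)))
           (allFin n))

Disjoint : ∀ {n} {G : Graph n} → EdgeSet G → EdgeSet G → Set
Disjoint {n} H₁ H₂ = ∀ (i j : Fin n) → E H₁ i j ≡ true → E H₂ i j ≡ false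

-- Isomorphism of the (edge-induced) subgraphs with edge sets H₁, H₂:
-- a permutation σ of the vertex set carrying the edges of H₁ exactly
-- onto the edges of H₂.
Isomorphic : ∀ {n} {G : Graph n} → EdgeSet G → EdgeSet G → Set
Isomorphic {n} H₁ H₂ =
  Σ (Fin n ↔ Fin n) λ σ →
    ∀ (i j : Fin n) → E H₁ i j ≡ E H₂ (Inverse.to σ i) (Inverse.to σ j)

HasIsoPair : ∀ {n} → Graph n → ℕ → Set
HasIsoPair G s =
  Σ (EdgeSet G) λ H₁ → Σ (EdgeSet G) λ H₂ →
    Disjoint H₁ H₂ × Isomorphic H₁ H₂ ×
    edgeCount (E H₁) ≡ s × edgeCount (E H₂) ≡ s

module Submission where

-- 1. Deleting edges whose endpoints both have other neighbours, G shrinks to a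
--    spanning star forest S without isolated vertices ('spanningStarForest').
-- 2. By well-founded induction on the number of edges, every star forest S has
--    such a pair with nonIsolated S ≤ 4s + 2 ('starForestBound').  If some
--    centre c has two leaves x, y, delete the star of c (or just x, y when c has
--    at least four leaves), recurse, add cx to the first subgraph and cy to the
--    second, and compose the permutation with the transposition (x y).  If all
--    components are single edges ab, a'b', delete both and swap them by
--    (a a')(b b').  Otherwise S has at most one edge.  Each step adds one edge
--    to each subgraph and deletes at most four vertices.
-- 3. The permutation only ever moves leaves ('LeafIsoPair'); this invariant is
--    what makes the extension of step 2 work ('extend').

open import Defs hiding (sym)
open import Data.Bool using (Bool; true; false; _∧_; _∨_; not; if_then_else_) renaming (_≟_ to _≟B_)
open import Data.Bool.Properties using (∨-comm; ∧-comm; ∧-zeroʳ; ⇔→≡)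
open import Function.Bundles using (mk⇔)
open import Data.Nat using (ℕ; zero; suc; _+_; _*_; _∸_; _≤_; _<_; z≤n; s≤s)
open import Data.Nat.Properties
  using (≤-refl; ≤-trans; ≤-reflexive; +-mono-≤; +-mono-<-≤; +-mono-≤-<; +-comm;
         +-identityʳ; *-identityʳ; +-*-semiring; ∸-monoˡ-≤; m+n∸n≡m; module ≤-Reasoning)
open import Data.Fin using (Fin; zero; suc; _<?_) renaming (_<_ to _<F_)
open import Relation.Binary.Definitions using (tri<; tri≈; tri>)
open import Data.Fin.Properties using (_≟_; suc-injective; <-cmp; <-asym; any?)
open import Data.List using (List; []; _∷_; length; map; allFin; tabulate)
open import Data.List.Properties using (map-tabulate)
import Data.Nat.ListAction as List
open import Data.Product using (∃-syntax; _×_; _,_; proj₁; proj₂)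
open import Data.Sum using (_⊎_; inj₁; inj₂; [_,_]; [_,_]′)
open import Function using (_∘_)
open import Data.Nat.Tactic.RingSolver using (solve-∀)
open import Data.List.Membership.Propositional using (_∈_; _∉_)
import Data.List.Relation.Unary.Any as Any
open import Data.List.Relation.Unary.Any using (here; there)
open import Data.List.Relation.Unary.All using (All; []; _∷_)
import Data.List.Relation.Unary.All as All
import Relation.Nullary.Decidable as Dec
open import Data.Fin.Permutation using (Permutation′; _⟨$⟩ʳ_; _⟨$⟩ˡ_; inverseˡ; transpose; _∘ₚ_)
import Data.Fin.Permutation as Perm
open import Induction.WellFounded using (Acc; acc)
open import Data.Nat.Induction using (<-wellFounded)
open import Data.Empty using (⊥)
open import Relation.Nullary using (¬_; Dec; yes; no; contradiction)
open import Relation.Nullary.Decidable using (⌊_⌋; ⌊⌋-map′; _×-dec_; ¬?; decidable-stable; dec-true; dec-false)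
open import Relation.Binary.PropositionalEquality
  using (_≡_; _≢_; refl; sym; trans; cong; cong₂; subst; subst₂; module ≡-Reasoning)
open import Algebra.Properties.Semiring.Sum +-*-semiring
  using (sum; sum-cong-≗; ∑-distrib-+; *-distribˡ-sum)

ind : Bool → ℕ
ind b = if b then 1 else 0

isYes-true : ∀ {A : Set} (d : Dec A) → A → ⌊ d ⌋ ≡ true
isYes-true (yes _) _ = refl
isYes-true (no ¬a) a = contradiction a ¬a

isYes-false : ∀ {A : Set} (d : Dec A) → ¬ A → ⌊ d ⌋ ≡ false
isYes-false (yes a) ¬a = contradiction a ¬a
isYes-false (no _)  _  = refl

isYes-sound : ∀ {A : Set} (d : Dec A) → ⌊ d ⌋ ≡ true → A
isYes-sound (yes a) _ = a

sum-mono : ∀ {n} {f g : Fin n → ℕ} → (∀ i → f i ≤ g i) → sum f ≤ sum g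
sum-mono {zero}  f≤g = z≤n
sum-mono {suc n} f≤g = +-mono-≤ (f≤g zero) (sum-mono (f≤g ∘ suc))

sum-strict : ∀ {n} {f g : Fin n → ℕ} → (∀ i → f i ≤ g i) →
             ∀ k → f k < g k → sum f < sum g
sum-strict {suc n} f≤g zero    f<g = +-mono-<-≤ f<g (sum-mono (f≤g ∘ suc))
sum-strict {suc n} f≤g (suc k) f<g = +-mono-≤-< (f≤g zero) (sum-strict (f≤g ∘ suc) k f<g)

sum-zero : ∀ {n} (f : Fin n → ℕ) → (∀ i → f i ≡ 0) → sum f ≡ 0
sum-zero {zero}  f f≡0 = refl
sum-zero {suc n} f f≡0 = cong₂ _+_ (f≡0 zero) (sum-zero (f ∘ suc) (f≡0 ∘ suc))

sum-one : ∀ {n} → sum {n} (λ _ → 1) ≡ n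
sum-one {zero}  = refl
sum-one {suc n} = cong suc (sum-one {n})

sum-point : ∀ {n} (p : Fin n) → sum (λ i → ind ⌊ i ≟ p ⌋) ≡ 1
sum-point {suc n} zero    = cong suc (sum-zero {n} _ (λ i → refl))
sum-point {suc n} (suc p) =
  trans (sum-cong-≗ (λ i → cong ind (⌊⌋-map′ (cong suc) suc-injective (i ≟ p)))) (sum-point p)

listSum-tabulate : ∀ {n} (f : Fin n → ℕ) → List.sum (tabulate f) ≡ sum f
listSum-tabulate {zero}  f = refl
listSum-tabulate {suc n} f = cong (f zero +_) (listSum-tabulate (f ∘ suc))

listSum-allFin : ∀ {n} (f : Fin n → ℕ) → List.sum (map f (allFin n)) ≡ sum f
listSum-allFin f = trans (cong List.sum (map-tabulate (λ i → i) f)) (listSum-tabulate f)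

∧-true : ∀ {x y} → x ∧ y ≡ true → x ≡ true × y ≡ true
∧-true {true} y≡true = refl , y≡true

∨-true : ∀ {x y} → x ∨ y ≡ true → x ≡ true ⊎ y ≡ true
∨-true {true}  _      = inj₁ refl
∨-true {false} y≡true = inj₂ y≡true

≢true : ∀ {x} → ¬ (x ≡ true) → x ≡ false
≢true {false} _ = refl
≢true {true}  h = contradiction refl h

bool-ext : ∀ {x y} → (x ≡ true → y ≡ true) → (y ≡ true → x ≡ true) → x ≡ y
bool-ext x⇒y y⇒x = ⇔→≡ (mk⇔ x⇒y y⇒x)

≟-injective : ∀ {m n} (f : Fin m → Fin n) → (∀ {i j} → f i ≡ f j → i ≡ j) →
              ∀ i j → ⌊ f i ≟ f j ⌋ ≡ ⌊ i ≟ j ⌋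
≟-injective f inj i j with i ≟ j
... | yes refl = isYes-true (f i ≟ f i) refl
... | no  i≢j  = isYes-false (f i ≟ f j) (i≢j ∘ inj)

≟-self : ∀ {n} (i : Fin n) → ⌊ i ≟ i ⌋ ≡ true
≟-self i = isYes-true (i ≟ i) refl

∑∑ : ∀ {n} → (Fin n → Fin n → ℕ) → ℕ
∑∑ {n} f = sum {n} (λ i → sum {n} (f i))

∑∑-cong : ∀ {n} {f g : Fin n → Fin n → ℕ} → (∀ i j → f i j ≡ g i j) → ∑∑ f ≡ ∑∑ g
∑∑-cong f≡g = sum-cong-≗ (λ i → sum-cong-≗ (f≡g i))

∑∑-distrib-+ : ∀ {n} (f g : Fin n → Fin n → ℕ) →
               ∑∑ (λ i j → f i j + g i j) ≡ ∑∑ f + ∑∑ g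
∑∑-distrib-+ {n} f g = trans (sum-cong-≗ (λ i → ∑-distrib-+ (f i) (g i)))
                             (∑-distrib-+ {n} (λ i → sum (f i)) (λ i → sum (g i)))

ordered : ∀ {n} → (Fin n → Fin n → Bool) → Fin n → Fin n → ℕ
ordered E i j = ind (⌊ i <? j ⌋ ∧ E i j)

edgeCount-sum : ∀ {n} (E : Fin n → Fin n → Bool) → edgeCount E ≡ ∑∑ (ordered E)
edgeCount-sum {n} E = trans (listSum-allFin {n} (λ i → List.sum (map (ordered E i) (allFin n))))
                             (sum-cong-≗ (λ i → listSum-allFin (ordered E i)))

edgeCount-cong : ∀ {n} {E F : Fin n → Fin n → Bool} → (∀ i j → E i j ≡ F i j) →
                 edgeCount E ≡ edgeCount F
edgeCount-cong {E = E} {F} E≡F = begin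
  edgeCount E        ≡⟨ edgeCount-sum E ⟩
  ∑∑ (ordered E)     ≡⟨ ∑∑-cong (λ i j → cong (λ b → ind (⌊ i <? j ⌋ ∧ b)) (E≡F i j)) ⟩
  ∑∑ (ordered F)     ≡⟨ edgeCount-sum F ⟨
  edgeCount F        ∎
  where open ≡-Reasoning

edgeCount-empty : ∀ {n} → edgeCount {n} (λ _ _ → false) ≡ 0
edgeCount-empty {n} = trans (edgeCount-sum {n} _)
  (sum-zero {n} _ (λ i → sum-zero {n} _ (λ j → cong ind (∧-zeroʳ ⌊ i <? j ⌋))))

edgeCount-∪ : ∀ {n} (E F : Fin n → Fin n → Bool) →
              (∀ i j → E i j ≡ true → F i j ≡ false) →
              edgeCount (λ i j → E i j ∨ F i j) ≡ edgeCount E + edgeCount F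
edgeCount-∪ E F disjoint = begin
  edgeCount (λ i j → E i j ∨ F i j)                 ≡⟨ edgeCount-sum (λ i j → E i j ∨ F i j) ⟩
  ∑∑ (ordered (λ i j → E i j ∨ F i j))
    ≡⟨ ∑∑-cong (λ i j → split ⌊ i <? j ⌋ (E i j) (F i j) (disjoint i j)) ⟩
  ∑∑ (λ i j → ordered E i j + ordered F i j)        ≡⟨ ∑∑-distrib-+ (ordered E) (ordered F) ⟩
  ∑∑ (ordered E) + ∑∑ (ordered F)                   ≡⟨ cong₂ _+_ (edgeCount-sum E) (edgeCount-sum F) ⟨
  edgeCount E + edgeCount F                         ∎
  where
  open ≡-Reasoning
  split : ∀ l e f → (e ≡ true → f ≡ false) → ind (l ∧ (e ∨ f)) ≡ ind (l ∧ e) + ind (l ∧ f)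
  split false e     f     _ = refl
  split true  false f     _ = refl
  split true  true  false _ = refl
  split true  true  true  h = contradiction (h refl) (λ ())

edge : ∀ {n} → Fin n → Fin n → Fin n → Fin n → Bool
edge p q i j = (⌊ i ≟ p ⌋ ∧ ⌊ j ≟ q ⌋) ∨ (⌊ i ≟ q ⌋ ∧ ⌊ j ≟ p ⌋)

edge-sym : ∀ {n} (p q i j : Fin n) → edge p q i j ≡ edge p q j i
edge-sym p q i j = trans (cong₂ _∨_ (∧-comm ⌊ i ≟ p ⌋ ⌊ j ≟ q ⌋) (∧-comm ⌊ i ≟ q ⌋ ⌊ j ≟ p ⌋))
                         (∨-comm (⌊ j ≟ q ⌋ ∧ ⌊ i ≟ p ⌋) (⌊ j ≟ p ⌋ ∧ ⌊ i ≟ q ⌋))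

edge-flip : ∀ {n} (p q i j : Fin n) → edge p q i j ≡ edge q p i j
edge-flip p q i j = ∨-comm (⌊ i ≟ p ⌋ ∧ ⌊ j ≟ q ⌋) _

edge-at : ∀ {n} (p q : Fin n) → edge p q p q ≡ true
edge-at p q rewrite ≟-self p | ≟-self q = refl

edge-true : ∀ {n} {p q i j : Fin n} → edge p q i j ≡ true → (i ≡ p × j ≡ q) ⊎ (i ≡ q × j ≡ p)
edge-true {p = p} {q} {i} {j} h with ∨-true {⌊ i ≟ p ⌋ ∧ ⌊ j ≟ q ⌋} h
... | inj₁ h₁ = inj₁ (isYes-sound (i ≟ p) (proj₁ (∧-true h₁)) , isYes-sound (j ≟ q) (proj₂ (∧-true h₁)))
... | inj₂ h₂ = inj₂ (isYes-sound (i ≟ q) (proj₁ (∧-true h₂)) , isYes-sound (j ≟ p) (proj₂ (∧-true h₂)))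

edge-off : ∀ {n} {p q i j : Fin n} → ¬ ((i ≡ p × j ≡ q) ⊎ (i ≡ q × j ≡ p)) → edge p q i j ≡ false
edge-off ¬endpoints = ≢true (¬endpoints ∘ edge-true)

edge-relabel : ∀ {n} (f : Fin n → Fin n) → (∀ {i j} → f i ≡ f j → i ≡ j) →
               ∀ p q i j → edge (f p) (f q) (f i) (f j) ≡ edge p q i j
edge-relabel f inj p q i j
  rewrite ≟-injective f inj i p | ≟-injective f inj j q
        | ≟-injective f inj i q | ≟-injective f inj j p = refl

ordered-edge : ∀ {n} {p q : Fin n} → p <F q → ∀ i j →
               ordered (edge p q) i j ≡ ind ⌊ i ≟ p ⌋ * ind ⌊ j ≟ q ⌋
ordered-edge {p = p} {q} p<q i j =
  trans (cong ind (bool-ext counted→pq pq→counted)) (ind-∧ ⌊ i ≟ p ⌋ ⌊ j ≟ q ⌋)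
  where
  ind-∧ : ∀ x y → ind (x ∧ y) ≡ ind x * ind y
  ind-∧ false y = refl
  ind-∧ true  y = sym (+-identityʳ (ind y))
  counted→pq : ⌊ i <? j ⌋ ∧ edge p q i j ≡ true → ⌊ i ≟ p ⌋ ∧ ⌊ j ≟ q ⌋ ≡ true
  counted→pq h with edge-true {p = p} {q} {i} {j} (proj₂ (∧-true h))
  ... | inj₁ (refl , refl) rewrite ≟-self p | ≟-self q = refl
  ... | inj₂ (refl , refl) = contradiction (isYes-sound (q <? p) (proj₁ (∧-true h))) (<-asym p<q)
  pq→counted : ⌊ i ≟ p ⌋ ∧ ⌊ j ≟ q ⌋ ≡ true → ⌊ i <? j ⌋ ∧ edge p q i j ≡ true
  pq→counted h with isYes-sound (i ≟ p) (proj₁ (∧-true h)) | isYes-sound (j ≟ q) (proj₂ (∧-true h))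
  ... | refl | refl rewrite isYes-true (p <? q) p<q = edge-at p q

edgeCount-ordered-edge : ∀ {n} {p q : Fin n} → p <F q → edgeCount (edge p q) ≡ 1
edgeCount-ordered-edge {n} {p} {q} p<q = begin
  edgeCount (edge p q)                                      ≡⟨ edgeCount-sum (edge p q) ⟩
  ∑∑ (ordered (edge p q))                                   ≡⟨ ∑∑-cong (ordered-edge p<q) ⟩
  sum (λ i → sum (λ j → ind ⌊ i ≟ p ⌋ * ind ⌊ j ≟ q ⌋))
    ≡⟨ sum-cong-≗ (λ i → *-distribˡ-sum (ind ⌊ i ≟ p ⌋) (λ j → ind ⌊ j ≟ q ⌋)) ⟨
  sum (λ i → ind ⌊ i ≟ p ⌋ * sum (λ j → ind ⌊ j ≟ q ⌋))
    ≡⟨ sum-cong-≗ (λ i → trans (cong (ind ⌊ i ≟ p ⌋ *_) (sum-point q)) (*-identityʳ _)) ⟩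
  sum (λ i → ind ⌊ i ≟ p ⌋)                                 ≡⟨ sum-point p ⟩
  1                                                         ∎
  where open ≡-Reasoning

edgeCount-edge : ∀ {n} {p q : Fin n} → p ≢ q → edgeCount (edge p q) ≡ 1
edgeCount-edge {p = p} {q} p≢q with <-cmp p q
... | tri< p<q _ _ = edgeCount-ordered-edge p<q
... | tri≈ _ p≡q _ = contradiction p≡q p≢q
... | tri> _ _ q<p = trans (edgeCount-cong (edge-flip p q)) (edgeCount-ordered-edge q<p)

infix 4 _⊆_
_⊆_ : ∀ {n} → Graph n → Graph n → Set
S ⊆ G = ∀ i j → Adj S i j ≡ true → Adj G i j ≡ true

⊆-trans : ∀ {n} {R S G : Graph n} → R ⊆ S → S ⊆ G → R ⊆ G
⊆-trans R⊆S S⊆G i j = S⊆G i j ∘ R⊆S i j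

Isolated : ∀ {n} → Graph n → Fin n → Set
Isolated S v = ∀ u → Adj S v u ≡ false

OnlyNeighbour : ∀ {n} → Graph n → Fin n → Fin n → Set
OnlyNeighbour S v u = ∀ w → Adj S v w ≡ true → w ≡ u

Leaf : ∀ {n} → Graph n → Fin n → Set
Leaf S v = ∃[ u ] Adj S v u ≡ true × OnlyNeighbour S v u

Branching : ∀ {n} → Graph n → Fin n → Set
Branching S v = ∃[ a ] ∃[ b ] a ≢ b × Adj S v a ≡ true × Adj S v b ≡ true

StarForest : ∀ {n} → Graph n → Set
StarForest S = ∀ u v → Adj S u v ≡ true → OnlyNeighbour S u v ⊎ OnlyNeighbour S v u

adj-sym : ∀ {n} (S : Graph n) {a b} → Adj S a b ≡ true → Adj S b a ≡ true
adj-sym S {a} {b} ab = trans (Graph.sym S b a) ab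

adj-irrefl : ∀ {n} (S : Graph n) {a b} → Adj S a b ≡ true → a ≢ b
adj-irrefl S {a} ab refl = contradiction (trans (sym ab) (irrefl S a)) (λ ())

isolated-not-adj : ∀ {n} {S : Graph n} {v u} → Isolated S v → Adj S v u ≡ true → ⊥
isolated-not-adj {u = u} iso vu = contradiction (trans (sym vu) (iso u)) (λ ())

isolated-not-leaf : ∀ {n} {S : Graph n} {v} → Isolated S v → ¬ Leaf S v
isolated-not-leaf {S = S} iso (u , vu , _) = isolated-not-adj {S = S} iso vu

branching-not-leaf : ∀ {n} {S : Graph n} {v} → Branching S v → ¬ Leaf S v
branching-not-leaf (a , b , a≢b , va , vb) (u , _ , only) = a≢b (trans (only a va) (sym (only b vb)))

starForest-⊆ : ∀ {n} {S S' : Graph n} → S' ⊆ S → StarForest S → StarForest S'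
starForest-⊆ S'⊆S sf u v uv with sf u v (S'⊆S u v uv)
... | inj₁ only = inj₁ (λ w uw → only w (S'⊆S u w uw))
... | inj₂ only = inj₂ (λ w vw → only w (S'⊆S v w vw))

restrict : ∀ {n} (G : Graph n) (K : Fin n → Fin n → Bool) → (∀ i j → K i j ≡ K j i) → Graph n
restrict G K K-sym = record
  { Adj    = λ i j → Adj G i j ∧ K i j
  ; sym    = λ i j → cong₂ _∧_ (Graph.sym G i j) (K-sym i j)
  ; irrefl = λ i → cong (_∧ K i i) (irrefl G i) }

restrict-⊆ : ∀ {n} (G : Graph n) K K-sym → restrict G K K-sym ⊆ G
restrict-⊆ G K K-sym i j h = proj₁ (∧-true {Adj G i j} h)

restrict-keeps : ∀ {n} (G : Graph n) K K-sym {i j} →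
                 Adj G i j ≡ true → K i j ≡ true → Adj (restrict G K K-sym) i j ≡ true
restrict-keeps G K K-sym ij Kij rewrite ij | Kij = refl

arcCount : ∀ {n} → Graph n → ℕ
arcCount G = ∑∑ (λ i j → ind (Adj G i j))

restrict-< : ∀ {n} (G : Graph n) K K-sym {u v} → Adj G u v ≡ true → K u v ≡ false →
             arcCount (restrict G K K-sym) < arcCount G
restrict-< G K K-sym {u} {v} uv Kuv =
  sum-strict (λ i → sum-mono (λ j → ind-∧≤ (Adj G i j) (K i j))) u
    (sum-strict (λ j → ind-∧≤ (Adj G u j) (K u j)) v dropped)
  where
  ind-∧≤ : ∀ a b → ind (a ∧ b) ≤ ind a
  ind-∧≤ false b     = z≤n
  ind-∧≤ true  false = z≤n
  ind-∧≤ true  true  = ≤-refl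
  dropped : ind (Adj G u v ∧ K u v) < ind (Adj G u v)
  dropped rewrite uv | Kuv = s≤s z≤n

OtherNeighbour : ∀ {n} → Graph n → Fin n → Fin n → Set
OtherNeighbour S u v = ∃[ w ] Adj S u w ≡ true × w ≢ v

otherNeighbour? : ∀ {n} (S : Graph n) u v → Dec (OtherNeighbour S u v)
otherNeighbour? S u v = any? (λ w → (Adj S u w ≟B true) ×-dec ¬? (w ≟ v))

only-or-other : ∀ {n} (S : Graph n) u v → OnlyNeighbour S u v ⊎ OtherNeighbour S u v
only-or-other S u v with otherNeighbour? S u v
... | yes other = inj₂ other
... | no ¬other = inj₁ (λ w uw → decidable-stable (w ≟ v) (λ w≢v → ¬other (w , uw , w≢v)))

-- An edge is removable if both its endpoints have further neighbours; deleting
-- it creates no isolated vertex.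
Removable : ∀ {n} → Graph n → Fin n → Fin n → Set
Removable G u v = Adj G u v ≡ true × OtherNeighbour G u v × OtherNeighbour G v u

removable? : ∀ {n} (G : Graph n) → Dec (∃[ u ] ∃[ v ] Removable G u v)
removable? G = any? (λ u → any? (λ v →
  (Adj G u v ≟B true) ×-dec otherNeighbour? G u v ×-dec otherNeighbour? G v u))

noRemovable⇒starForest : ∀ {n} (G : Graph n) → ¬ (∃[ u ] ∃[ v ] Removable G u v) → StarForest G
noRemovable⇒starForest G ¬rem u v uv with only-or-other G u v | only-or-other G v u
... | inj₁ only | _         = inj₁ only
... | inj₂ _    | inj₁ only = inj₂ only
... | inj₂ uw   | inj₂ vu   = contradiction (u , v , uv , uw , vu) ¬rem

deleteEdge : ∀ {n} → Graph n → Fin n → Fin n → Graph n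
deleteEdge G u v = restrict G (λ i j → not (edge u v i j)) (λ i j → cong not (edge-sym u v i j))

deleteEdge-⊆ : ∀ {n} (G : Graph n) u v → deleteEdge G u v ⊆ G
deleteEdge-⊆ G u v = restrict-⊆ G _ (λ i j → cong not (edge-sym u v i j))

deleteEdge-< : ∀ {n} (G : Graph n) {u v} → Adj G u v ≡ true → arcCount (deleteEdge G u v) < arcCount G
deleteEdge-< G {u} {v} uv = restrict-< G _ (λ i j → cong not (edge-sym u v i j)) uv (cong not (edge-at u v))

deleteEdge-keeps : ∀ {n} (G : Graph n) {u v i j} → Adj G i j ≡ true → edge u v i j ≡ false →
                   Adj (deleteEdge G u v) i j ≡ true
deleteEdge-keeps G {u} {v} ij off = restrict-keeps G _ (λ i j → cong not (edge-sym u v i j)) ij (cong not off)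

-- The endpoints of a deleted removable edge keep their other neighbours.
deleteEdge-noIsolated : ∀ {n} (G : Graph n) {u v} → Removable G u v → NoIsolated G →
                        NoIsolated (deleteEdge G u v)
deleteEdge-noIsolated G {u} {v} (uv , (w , uw , w≢v) , (w' , vw' , w'≢u)) noIso x
  with noIso x
... | y , xy with edge u v x y in e
...   | false = y , deleteEdge-keeps G xy e
...   | true with edge-true {p = u} {v} {x} {y} e
...     | inj₁ (refl , refl) =
          w , deleteEdge-keeps G uw (edge-off [ w≢v ∘ proj₂ , adj-irrefl G uv ∘ proj₁ ])
...     | inj₂ (refl , refl) =
          w' , deleteEdge-keeps G vw' (edge-off [ adj-irrefl G uv ∘ sym ∘ proj₁ , w'≢u ∘ proj₂ ])

spanningStarForest : ∀ {n} (G : Graph n) → Acc _<_ (arcCount G) → NoIsolated G →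
                     ∃[ S ] S ⊆ G × NoIsolated S × StarForest S
spanningStarForest G (acc smaller) noIso with removable? G
... | no ¬rem = G , (λ i j h → h) , noIso , noRemovable⇒starForest G ¬rem
... | yes (u , v , rem)
  with spanningStarForest (deleteEdge G u v) (smaller (deleteEdge-< G (proj₁ rem)))
                          (deleteEdge-noIsolated G rem noIso)
...   | S , S⊆G' , noIsoS , sfS =
          S , ⊆-trans {R = S} {deleteEdge G u v} {G} S⊆G' (deleteEdge-⊆ G u v) , noIsoS , sfS

_∈?_ : ∀ {n} (v : Fin n) (ks : List (Fin n)) → Dec (v ∈ ks)
v ∈? ks = Any.any? (v ≟_) ks

ind-≤ : ∀ {A B : Set} (a? : Dec A) (b? : Dec B) → (A → B) → ind ⌊ a? ⌋ ≤ ind ⌊ b? ⌋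
ind-≤ (no _)  b?      _   = z≤n
ind-≤ (yes a) (yes _) _   = ≤-refl
ind-≤ (yes a) (no ¬b) a→b = contradiction (a→b a) ¬b

ind-≤-+ : ∀ {A B C : Set} (a? : Dec A) (b? : Dec B) (c? : Dec C) → (A → B ⊎ C) →
          ind ⌊ a? ⌋ ≤ ind ⌊ b? ⌋ + ind ⌊ c? ⌋
ind-≤-+ (no _)  b?      c?      _ = z≤n
ind-≤-+ (yes _) (yes _) c?      _ = s≤s z≤n
ind-≤-+ (yes a) (no ¬b) c?      split with split a
... | inj₁ b = contradiction b ¬b
... | inj₂ c = ind-≤ (yes a) c? (λ _ → c)

sum-∈ : ∀ {n} (ks : List (Fin n)) → sum (λ v → ind ⌊ v ∈? ks ⌋) ≤ length ks
sum-∈ {n} []       = ≤-reflexive (sum-zero {n} _ (λ _ → refl))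
sum-∈ {n} (k ∷ ks) = begin
  sum (λ v → ind ⌊ v ∈? (k ∷ ks) ⌋)
    ≤⟨ sum-mono (λ v → ind-≤-+ (v ∈? (k ∷ ks)) (v ≟ k) (v ∈? ks) Any.toSum) ⟩
  sum (λ v → ind ⌊ v ≟ k ⌋ + ind ⌊ v ∈? ks ⌋)     ≡⟨ ∑-distrib-+ {n} _ _ ⟩
  sum (λ v → ind ⌊ v ≟ k ⌋) + sum (λ v → ind ⌊ v ∈? ks ⌋)
    ≤⟨ +-mono-≤ (≤-reflexive (sum-point k)) (sum-∈ ks) ⟩
  suc (length ks)                                 ∎
  where open ≤-Reasoning

infixl 6 _─_
_─_ : ∀ {n} → Graph n → List (Fin n) → Graph n
S ─ ks = restrict S (λ i j → not ⌊ i ∈? ks ⌋ ∧ not ⌊ j ∈? ks ⌋)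
                    (λ i j → ∧-comm (not ⌊ i ∈? ks ⌋) _)

─-⊆ : ∀ {n} (S : Graph n) ks → S ─ ks ⊆ S
─-⊆ S ks = restrict-⊆ S _ (λ i j → ∧-comm (not ⌊ i ∈? ks ⌋) _)

─-isolated : ∀ {n} (S : Graph n) {ks v} → v ∈ ks → Isolated (S ─ ks) v
─-isolated S {ks} {v} v∈ks u rewrite isYes-true (v ∈? ks) v∈ks = ∧-zeroʳ (Adj S v u)

─-keeps : ∀ {n} (S : Graph n) {ks v u} → v ∉ ks → u ∉ ks → Adj S v u ≡ true →
          Adj (S ─ ks) v u ≡ true
─-keeps S {ks} {v} {u} v∉ks u∉ks vu
  rewrite vu | isYes-false (v ∈? ks) v∉ks | isYes-false (u ∈? ks) u∉ks = refl

─-< : ∀ {n} (S : Graph n) {ks u v} → Adj S u v ≡ true → v ∈ ks → arcCount (S ─ ks) < arcCount S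
─-< S {ks} {u} {v} uv v∈ks =
  restrict-< S _ (λ i j → ∧-comm (not ⌊ i ∈? ks ⌋) _) uv
    (trans (cong (λ b → not ⌊ u ∈? ks ⌋ ∧ not b) (isYes-true (v ∈? ks) v∈ks))
           (∧-zeroʳ (not ⌊ u ∈? ks ⌋)))

HasNeighbour : ∀ {n} → Graph n → Fin n → Set
HasNeighbour S v = ∃[ u ] Adj S v u ≡ true

hasNeighbour? : ∀ {n} (S : Graph n) v → Dec (HasNeighbour S v)
hasNeighbour? S v = any? (λ u → Adj S v u ≟B true)

nonIsolated : ∀ {n} → Graph n → ℕ
nonIsolated S = sum (λ v → ind ⌊ hasNeighbour? S v ⌋)

nonIsolated-spanning : ∀ {n} (S : Graph n) → NoIsolated S → nonIsolated S ≡ n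
nonIsolated-spanning S noIso =
  trans (sum-cong-≗ (λ v → cong ind (isYes-true (hasNeighbour? S v) (noIso v)))) sum-one

nonIsolated-inside : ∀ {n} (S : Graph n) ks → (∀ v u → Adj S v u ≡ true → v ∈ ks) →
                     nonIsolated S ≤ length ks
nonIsolated-inside S ks inside =
  ≤-trans (sum-mono (λ v → ind-≤ (hasNeighbour? S v) (v ∈? ks) (λ (u , vu) → inside v u vu)))
          (sum-∈ ks)

nonIsolated-─ : ∀ {n} (S : Graph n) ks →
                (∀ v u → v ∉ ks → Adj S v u ≡ true → HasNeighbour (S ─ ks) v) →
                nonIsolated S ≤ nonIsolated (S ─ ks) + length ks
nonIsolated-─ {n} S ks keeps = begin
  nonIsolated S
    ≤⟨ sum-mono (λ v → ind-≤-+ (hasNeighbour? S v) (hasNeighbour? (S ─ ks) v) (v ∈? ks) (split v)) ⟩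
  sum (λ v → ind ⌊ hasNeighbour? (S ─ ks) v ⌋ + ind ⌊ v ∈? ks ⌋)   ≡⟨ ∑-distrib-+ {n} _ _ ⟩
  nonIsolated (S ─ ks) + sum (λ v → ind ⌊ v ∈? ks ⌋)              ≤⟨ +-mono-≤ ≤-refl (sum-∈ ks) ⟩
  nonIsolated (S ─ ks) + length ks                                ∎
  where
  open ≤-Reasoning
  split : ∀ v → HasNeighbour S v → HasNeighbour (S ─ ks) v ⊎ v ∈ ks
  split v (u , vu) = [ inj₂ , (λ v∉ks → inj₁ (keeps v u v∉ks vu)) ]′ (Dec.toSum (v ∈? ks))

-- Deleting ks is safe if every kept neighbour of a deleted vertex still has two
-- neighbours afterwards.  Then kept vertices keep a neighbour, and leaves of
-- the smaller graph were leaves before.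
SafeDeletion : ∀ {n} → Graph n → List (Fin n) → Set
SafeDeletion S ks = ∀ v u → Adj S v u ≡ true → u ∈ ks → v ∉ ks → Branching (S ─ ks) v

closed⇒safe : ∀ {n} (S : Graph n) ks → (∀ v u → Adj S v u ≡ true → u ∈ ks → v ∈ ks) →
              SafeDeletion S ks
closed⇒safe S ks closed v u vu u∈ks v∉ks = contradiction (closed v u vu u∈ks) v∉ks

safe-keepsNeighbour : ∀ {n} (S : Graph n) ks → SafeDeletion S ks →
                      ∀ v u → v ∉ ks → Adj S v u ≡ true → HasNeighbour (S ─ ks) v
safe-keepsNeighbour S ks safe v u v∉ks vu = [ viaBranching , viaKept ]′ (Dec.toSum (u ∈? ks))
  where
  viaBranching : u ∈ ks → HasNeighbour (S ─ ks) v
  viaBranching u∈ks with safe v u vu u∈ks v∉ks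
  ... | a , _ , _ , va , _ = a , va
  viaKept : u ∉ ks → HasNeighbour (S ─ ks) v
  viaKept u∉ks = u , ─-keeps S v∉ks u∉ks vu

safe-leaf : ∀ {n} (S : Graph n) ks → SafeDeletion S ks → ∀ {v} → Leaf (S ─ ks) v → Leaf S v
safe-leaf S ks safe {v} leaf@(u , vu , only) = u , ─-⊆ S ks v u vu , onlyInS
  where
  v∉ks : v ∉ ks
  v∉ks v∈ks = isolated-not-adj {S = S ─ ks} (─-isolated S v∈ks) vu
  onlyInS : OnlyNeighbour S v u
  onlyInS w vw =
    [ (λ w∈ks → contradiction leaf (branching-not-leaf {S = S ─ ks} (safe v w vw w∈ks v∉ks)))
    , (λ w∉ks → only w (─-keeps S v∉ks w∉ks vw)) ]′ (Dec.toSum (w ∈? ks))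

_⊑_ : ∀ {n} → (Fin n → Fin n → Bool) → Graph n → Set
H ⊑ S = ∀ i j → H i j ≡ true → Adj S i j ≡ true

⊑-isolated : ∀ {n} {H : Fin n → Fin n → Bool} (S : Graph n) → H ⊑ S →
             ∀ {x y} → Isolated S x ⊎ Isolated S y → H x y ≡ false
⊑-isolated S H⊑S {x} {y} isolated = ≢true λ xy →
  [ (λ iso → isolated-not-adj {S = S} iso (H⊑S x y xy))
  , (λ iso → isolated-not-adj {S = S} iso (adj-sym S (H⊑S x y xy))) ]′ isolated

perm-injective : ∀ {n} (π : Permutation′ n) {i j} → π ⟨$⟩ʳ i ≡ π ⟨$⟩ʳ j → i ≡ j
perm-injective π {i} {j} πi≡πj =
  trans (sym (inverseˡ π)) (trans (cong (π ⟨$⟩ˡ_) πi≡πj) (inverseˡ π))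

moved-image : ∀ {n} (π : Permutation′ n) {v} → π ⟨$⟩ʳ v ≢ v → π ⟨$⟩ʳ (π ⟨$⟩ʳ v) ≢ π ⟨$⟩ʳ v
moved-image π moved = moved ∘ perm-injective π

transpose-left : ∀ {n} (i j : Fin n) → transpose i j ⟨$⟩ʳ i ≡ j
transpose-left i j rewrite dec-true (i ≟ i) refl = refl

transpose-fix : ∀ {n} (i j k : Fin n) → k ≢ i → k ≢ j → transpose i j ⟨$⟩ʳ k ≡ k
transpose-fix i j k k≢i k≢j rewrite dec-false (k ≟ i) k≢i | dec-false (k ≟ j) k≢j = refl

transpose-moves : ∀ {n} (i j k : Fin n) → transpose i j ⟨$⟩ʳ k ≢ k → k ≡ i ⊎ k ≡ j
transpose-moves i j k moved = [ inj₁ , (λ k≢i → inj₂ (decidable-stable (k ≟ j)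
                                 (λ k≢j → moved (transpose-fix i j k k≢i k≢j)))) ]′ (Dec.toSum (k ≟ i))

∘ₚ-moves : ∀ {n} (π ρ : Permutation′ n) v → (π ∘ₚ ρ) ⟨$⟩ʳ v ≢ v →
           π ⟨$⟩ʳ v ≢ v ⊎ ρ ⟨$⟩ʳ v ≢ v
∘ₚ-moves π ρ v moved with π ⟨$⟩ʳ v ≟ v
... | yes πv≡v = inj₂ (moved ∘ trans (cong (ρ ⟨$⟩ʳ_) πv≡v))
... | no  πv≢v = inj₁ πv≢v

relabel-invisible : ∀ {n} (S : Graph n) (τ : Permutation′ n) → (∀ v → τ ⟨$⟩ʳ v ≢ v → Isolated S v) →
                    ∀ {H} → H ⊑ S → ∀ a b → H (τ ⟨$⟩ʳ a) (τ ⟨$⟩ʳ b) ≡ H a b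
relabel-invisible S τ moves-isolated {H} H⊑S a b with τ ⟨$⟩ʳ a ≟ a | τ ⟨$⟩ʳ b ≟ b
... | yes τa≡a | yes τb≡b = cong₂ H τa≡a τb≡b
... | no  τa≢a | _        = trans (⊑-isolated S H⊑S (inj₁ (moves-isolated _ (moved-image τ τa≢a))))
                                  (sym (⊑-isolated S H⊑S (inj₁ (moves-isolated a τa≢a))))
... | yes _    | no τb≢b  = trans (⊑-isolated S H⊑S (inj₂ (moves-isolated _ (moved-image τ τb≢b))))
                                  (sym (⊑-isolated S H⊑S (inj₂ (moves-isolated b τb≢b))))

-- Moving only leaves is the invariant that lets pairs be extended.
record LeafIsoPair {n} (S : Graph n) (s : ℕ) : Set where
  field
    H₁ H₂        : Fin n → Fin n → Bool
    H₁-sym       : ∀ i j → H₁ i j ≡ H₁ j i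
    H₂-sym       : ∀ i j → H₂ i j ≡ H₂ j i
    H₁⊑S         : H₁ ⊑ S
    H₂⊑S         : H₂ ⊑ S
    disjoint     : ∀ i j → H₁ i j ≡ true → H₂ i j ≡ false
    σ            : Permutation′ n
    σ-iso        : ∀ i j → H₁ i j ≡ H₂ (σ ⟨$⟩ʳ i) (σ ⟨$⟩ʳ j)
    count₁       : edgeCount H₁ ≡ s
    count₂       : edgeCount H₂ ≡ s
    moves-leaves : ∀ v → σ ⟨$⟩ʳ v ≢ v → Leaf S v

  fixes-nonLeaf : ∀ {v} → ¬ Leaf S v → σ ⟨$⟩ʳ v ≡ v
  fixes-nonLeaf {v} ¬leaf = decidable-stable (σ ⟨$⟩ʳ v ≟ v) (¬leaf ∘ moves-leaves v)

emptyPair : ∀ {n} (S : Graph n) → LeafIsoPair S 0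
emptyPair {n} S = record
  { H₁ = λ _ _ → false ; H₂ = λ _ _ → false
  ; H₁-sym = λ _ _ → refl ; H₂-sym = λ _ _ → refl
  ; H₁⊑S = λ _ _ () ; H₂⊑S = λ _ _ () ; disjoint = λ _ _ ()
  ; σ = Perm.id ; σ-iso = λ _ _ → refl
  ; count₁ = edgeCount-empty {n} ; count₂ = edgeCount-empty {n}
  ; moves-leaves = λ v moved → contradiction refl moved }

toHasIsoPair : ∀ {n} {S G : Graph n} {s} → S ⊆ G → LeafIsoPair S s → HasIsoPair G s
toHasIsoPair {S = S} {G} S⊆G pair =
  H₁′ , H₂′ , disjoint , (σ , σ-iso) , count₁ , count₂
  where
  open LeafIsoPair pair
  H₁′ H₂′ : EdgeSet G
  H₁′ = record { E = H₁ ; E-sym = H₁-sym ; E-sub = λ i j → S⊆G i j ∘ H₁⊑S i j }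
  H₂′ = record { E = H₂ ; E-sym = H₂-sym ; E-sub = λ i j → S⊆G i j ∘ H₂⊑S i j }

edge⊑ : ∀ {n} (S : Graph n) {p q} → Adj S p q ≡ true → edge p q ⊑ S
edge⊑ S pq i j e with edge-true {i = i} {j} e
... | inj₁ (refl , refl) = pq
... | inj₂ (refl , refl) = adj-sym S pq

edge-new : ∀ {n} (S : Graph n) {H} → H ⊑ S → ∀ {a b i j} → Isolated S b →
           H i j ≡ true → edge a b i j ≡ true → ⊥
edge-new S H⊑S {a} {b} {i} {j} iso Hij e with edge-true {p = a} {b} {i} {j} e
... | inj₁ (refl , refl) = contradiction (trans (sym Hij) (⊑-isolated S H⊑S (inj₂ iso))) (λ ())
... | inj₂ (refl , refl) = contradiction (trans (sym Hij) (⊑-isolated S H⊑S (inj₁ iso))) (λ ())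

-- The data for growing a pair on a subgraph S' of S by one edge pq, whose image
-- is the edge (τ p)(τ q).
record Extension {n} (S S' : Graph n) : Set where
  field
    S'⊆S         : S' ⊆ S
    leaf-reflect : ∀ {v} → Leaf S' v → Leaf S v
    τ            : Permutation′ n
    τ-moves      : ∀ v → τ ⟨$⟩ʳ v ≢ v → Isolated S' v × Leaf S v
    p q          : Fin n
    pq           : Adj S p q ≡ true
    τpτq         : Adj S (τ ⟨$⟩ʳ p) (τ ⟨$⟩ʳ q) ≡ true
    τq≢q         : τ ⟨$⟩ʳ q ≢ q
    τq≢p         : τ ⟨$⟩ʳ q ≢ p
    p-notLeaf    : ¬ Leaf S' p

extend : ∀ {n} {S S' : Graph n} {s} → Extension S S' → LeafIsoPair S' s → LeafIsoPair S (suc s)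
extend {n} {S} {S'} {s} ext pair = record
  { H₁ = H₁ ; H₂ = H₂
  ; H₁-sym = λ i j → cong₂ _∨_ (P.H₁-sym i j) (edge-sym p q i j)
  ; H₂-sym = λ i j → cong₂ _∨_ (P.H₂-sym i j) (edge-sym τp τq i j)
  ; H₁⊑S = ∪⊑ P.H₁⊑S pq ; H₂⊑S = ∪⊑ P.H₂⊑S τpτq
  ; disjoint = disjoint
  ; σ = P.σ ∘ₚ τ ; σ-iso = λ i j → cong₂ _∨_ (old-iso i j) (new-iso i j)
  ; count₁ = count P.H₁⊑S P.count₁ (adj-irrefl S pq) q-isolated
  ; count₂ = count P.H₂⊑S P.count₂ (adj-irrefl S τpτq) τq-isolated
  ; moves-leaves = moves-leaves }
  where
  open Extension ext
  module P = LeafIsoPair pair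
  τp τq : Fin n
  τp = τ ⟨$⟩ʳ p
  τq = τ ⟨$⟩ʳ q
  H₁ H₂ : Fin n → Fin n → Bool
  H₁ i j = P.H₁ i j ∨ edge p q i j
  H₂ i j = P.H₂ i j ∨ edge τp τq i j

  q-isolated : Isolated S' q
  q-isolated = proj₁ (τ-moves q τq≢q)
  τq-isolated : Isolated S' τq
  τq-isolated = proj₁ (τ-moves τq (moved-image τ τq≢q))

  ∪⊑ : ∀ {H a b} → H ⊑ S' → Adj S a b ≡ true → (λ i j → H i j ∨ edge a b i j) ⊑ S
  ∪⊑ {H} H⊑S' ab i j h = [ S'⊆S i j ∘ H⊑S' i j , edge⊑ S ab i j ]′ (∨-true {H i j} h)

  -- The old pair is untouched by τ, and σ fixes both ends of the new edge.
  old-iso : ∀ i j → P.H₁ i j ≡ P.H₂ (τ ⟨$⟩ʳ (P.σ ⟨$⟩ʳ i)) (τ ⟨$⟩ʳ (P.σ ⟨$⟩ʳ j))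
  old-iso i j = trans (P.σ-iso i j)
    (sym (relabel-invisible S' τ (λ v → proj₁ ∘ τ-moves v) P.H₂⊑S _ _))

  new-iso : ∀ i j → edge p q i j ≡ edge τp τq (τ ⟨$⟩ʳ (P.σ ⟨$⟩ʳ i)) (τ ⟨$⟩ʳ (P.σ ⟨$⟩ʳ j))
  new-iso i j = begin
    edge p q i j                                     ≡⟨ edge-relabel σ′ (perm-injective P.σ) p q i j ⟨
    edge (σ′ p) (σ′ q) (σ′ i) (σ′ j)                 ≡⟨ cong₂ (λ a b → edge a b (σ′ i) (σ′ j)) σp σq ⟩
    edge p q (σ′ i) (σ′ j)                           ≡⟨ edge-relabel (τ ⟨$⟩ʳ_) (perm-injective τ) p q _ _ ⟨
    edge τp τq (τ ⟨$⟩ʳ σ′ i) (τ ⟨$⟩ʳ σ′ j)           ∎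
    where
    open ≡-Reasoning
    σ′ : Fin n → Fin n
    σ′ = P.σ ⟨$⟩ʳ_
    σp : σ′ p ≡ p
    σp = P.fixes-nonLeaf p-notLeaf
    σq : σ′ q ≡ q
    σq = P.fixes-nonLeaf (isolated-not-leaf {S = S'} q-isolated)

  -- New edges avoid the old pair, and differ from each other as τ q ∉ {p, q}.
  disjoint : ∀ i j → H₁ i j ≡ true → H₂ i j ≡ false
  disjoint i j h = [ old , new ]′ (∨-true {P.H₁ i j} h)
    where
    old : P.H₁ i j ≡ true → H₂ i j ≡ false
    old h₁ = cong₂ _∨_ (P.disjoint i j h₁) (≢true (edge-new S' P.H₁⊑S τq-isolated h₁))
    distinct : edge p q i j ≡ true → edge τp τq i j ≡ true → ⊥
    distinct e e′ with edge-true {p = p} {q} {i} {j} e | edge-true {p = τp} {τq} {i} {j} e′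
    ... | inj₁ (refl , refl) | inj₁ (_ , q≡τq) = τq≢q (sym q≡τq)
    ... | inj₁ (refl , refl) | inj₂ (p≡τq , _) = τq≢p (sym p≡τq)
    ... | inj₂ (refl , refl) | inj₁ (_ , p≡τq) = τq≢p (sym p≡τq)
    ... | inj₂ (refl , refl) | inj₂ (q≡τq , _) = τq≢q (sym q≡τq)
    new : edge p q i j ≡ true → H₂ i j ≡ false
    new e = cong₂ _∨_ (≢true (λ h₂ → edge-new S' P.H₂⊑S q-isolated h₂ e)) (≢true (distinct e))

  -- Each side gains exactly one edge, as it has an end isolated in S'.
  count : ∀ {H a b} → H ⊑ S' → edgeCount H ≡ s → a ≢ b → Isolated S' b →
          edgeCount (λ i j → H i j ∨ edge a b i j) ≡ suc s
  count {H} {a} {b} H⊑S' countH a≢b b-isolated =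
    trans (edgeCount-∪ H (edge a b) (λ i j h → ≢true (edge-new S' H⊑S' b-isolated h)))
          (trans (cong₂ _+_ countH (edgeCount-edge a≢b)) (+-comm s 1))

  moves-leaves : ∀ v → τ ⟨$⟩ʳ (P.σ ⟨$⟩ʳ v) ≢ v → Leaf S v
  moves-leaves v moved with P.σ ⟨$⟩ʳ v ≟ v
  ... | yes σv≡v = proj₂ (τ-moves v (moved ∘ trans (cong (τ ⟨$⟩ʳ_) σv≡v)))
  ... | no  σv≢v = leaf-reflect (P.moves-leaves v σv≢v)

Bound : ∀ {n} → Graph n → Set
Bound S = ∃[ s ] LeafIsoPair S s × nonIsolated S ≤ 4 * s + 2

record Step {n} (S : Graph n) : Set where
  field
    deleted   : List (Fin n)
    few       : length deleted ≤ 4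
    safe      : SafeDeletion S deleted
    τ         : Permutation′ n
    τ-moves   : ∀ v → τ ⟨$⟩ʳ v ≢ v → v ∈ deleted × Leaf S v
    p q       : Fin n
    pq        : Adj S p q ≡ true
    τpτq      : Adj S (τ ⟨$⟩ʳ p) (τ ⟨$⟩ʳ q) ≡ true
    τq≢q      : τ ⟨$⟩ʳ q ≢ q
    τq≢p      : τ ⟨$⟩ʳ q ≢ p
    p-notLeaf : ¬ Leaf (S ─ deleted) p

  -- The edge pq loses its end q, which τ moves and hence is deleted.
  shrinks : arcCount (S ─ deleted) < arcCount S
  shrinks = ─-< S pq (proj₁ (τ-moves q τq≢q))

  -- Deleted vertices are isolated afterwards, and safety reflects leaves.
  extension : Extension S (S ─ deleted)
  extension = record
    { S'⊆S = ─-⊆ S deleted ; leaf-reflect = safe-leaf S deleted safe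
    ; τ = τ ; τ-moves = λ v moved → ─-isolated S (proj₁ (τ-moves v moved)) , proj₂ (τ-moves v moved)
    ; p = p ; q = q ; pq = pq ; τpτq = τpτq ; τq≢q = τq≢q ; τq≢p = τq≢p ; p-notLeaf = p-notLeaf }

  -- Each step adds one edge to the pair and at most four non-isolated vertices.
  step-bound : Bound (S ─ deleted) → Bound S
  step-bound (s , pair , bound) = suc s , extend extension pair , (begin
    nonIsolated S                                 ≤⟨ nonIsolated-─ S deleted (safe-keepsNeighbour S deleted safe) ⟩
    nonIsolated (S ─ deleted) + length deleted    ≤⟨ +-mono-≤ bound few ⟩
    4 * s + 2 + 4                                 ≡⟨ arithmetic s ⟩
    4 * suc s + 2                                 ∎)
    where
    open ≤-Reasoning
    arithmetic : ∀ s → 4 * s + 2 + 4 ≡ 4 * suc s + 2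
    arithmetic = solve-∀

branching? : ∀ {n} (S : Graph n) → Dec (∃[ v ] Branching S v)
branching? S = any? (λ v → any? (λ a → any? (λ b →
  ¬? (a ≟ b) ×-dec (Adj S v a ≟B true) ×-dec (Adj S v b ≟B true))))

EdgeOutside : ∀ {n} → Graph n → List (Fin n) → Set
EdgeOutside S ks = ∃[ u ] ∃[ v ] Adj S u v ≡ true × u ∉ ks

edgeOutside? : ∀ {n} (S : Graph n) ks → Dec (EdgeOutside S ks)
edgeOutside? S ks = any? (λ u → any? (λ v → (Adj S u v ≟B true) ×-dec ¬? (u ∈? ks)))

NeighbourOutside : ∀ {n} → Graph n → Fin n → List (Fin n) → Set
NeighbourOutside S c ks = ∃[ z ] Adj S c z ≡ true × z ∉ ks

neighbourOutside? : ∀ {n} (S : Graph n) c ks → Dec (NeighbourOutside S c ks)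
neighbourOutside? S c ks = any? (λ z → (Adj S c z ≟B true) ×-dec ¬? (z ∈? ks))

base-bound : ∀ {n} (S : Graph n) ks → ¬ EdgeOutside S ks → length ks ≤ 2 → Bound S
base-bound S ks ¬outside few = 0 , emptyPair S , ≤-trans (nonIsolated-inside S ks inside) few
  where
  inside : ∀ v u → Adj S v u ≡ true → v ∈ ks
  inside v u vu = decidable-stable (v ∈? ks) (λ v∉ks → ¬outside (v , u , vu , v∉ks))

centre-leaf : ∀ {n} {S : Graph n} → StarForest S → ∀ {c} → Branching S c →
              ∀ {u} → Adj S c u ≡ true → OnlyNeighbour S u c
centre-leaf sf {c} (a , b , a≢b , ca , cb) {u} cu with sf c u cu
... | inj₁ only = contradiction (trans (only a ca) (sym (only b cb))) a≢b
... | inj₂ only = only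

starStep : ∀ {n} {S : Graph n} → StarForest S → ∀ {c x y} → x ≢ y →
           Adj S c x ≡ true → Adj S c y ≡ true →
           ∀ deleted → x ∈ deleted → y ∈ deleted → length deleted ≤ 4 →
           SafeDeletion S deleted → ¬ Leaf (S ─ deleted) c → Step S
starStep {S = S} sf {c} {x} {y} x≢y cx cy deleted x∈ y∈ few safe c-notLeaf = record
  { deleted = deleted ; few = few ; safe = safe
  ; τ = transpose x y ; τ-moves = τ-moves
  ; p = c ; q = x ; pq = cx
  ; τpτq = subst₂ (λ a b → Adj S a b ≡ true) (sym τc) (sym (transpose-left x y)) cy
  ; τq≢q = λ y≡x → x≢y (sym (trans (sym (transpose-left x y)) y≡x))
  ; τq≢p = λ y≡c → adj-irrefl S cy (sym (trans (sym (transpose-left x y)) y≡c))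
  ; p-notLeaf = c-notLeaf }
  where
  branching : Branching S c
  branching = x , y , x≢y , cx , cy
  leaf : ∀ {u} → Adj S c u ≡ true → Leaf S u
  leaf cu = _ , adj-sym S cu , centre-leaf {S = S} sf branching cu
  τc : transpose x y ⟨$⟩ʳ c ≡ c
  τc = transpose-fix x y c (adj-irrefl S cx) (adj-irrefl S cy)
  τ-moves : ∀ v → transpose x y ⟨$⟩ʳ v ≢ v → v ∈ deleted × Leaf S v
  τ-moves v moved with transpose-moves x y v moved
  ... | inj₁ refl = x∈ , leaf cx
  ... | inj₂ refl = y∈ , leaf cy

star-closed : ∀ {n} {S : Graph n} → StarForest S → ∀ {c} → Branching S c → ∀ {ks} →
              ¬ NeighbourOutside S c ks → All (λ u → Adj S c u ≡ true) ks →
              ∀ v u → Adj S v u ≡ true → u ∈ c ∷ ks → v ∈ c ∷ ks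
star-closed {S = S} sf {c} br {ks} ¬outside nbrs v u vu (here refl) =
  there (decidable-stable (v ∈? ks) (λ v∉ks → ¬outside (v , adj-sym S vu , v∉ks)))
star-closed {S = S} sf {c} br {ks} ¬outside nbrs v u vu (there u∈ks) =
  here (centre-leaf {S = S} sf br (All.lookup nbrs u∈ks) v (adj-sym S vu))

wholeStarStep : ∀ {n} {S : Graph n} → StarForest S → ∀ {c x y} → x ≢ y →
                Adj S c x ≡ true → Adj S c y ≡ true →
                ∀ ks → x ∈ ks → y ∈ ks → length ks ≤ 3 →
                ¬ NeighbourOutside S c ks → All (λ u → Adj S c u ≡ true) ks → Step S
wholeStarStep {S = S} sf {c} x≢y cx cy ks x∈ y∈ few ¬outside nbrs =
  starStep sf x≢y cx cy (c ∷ ks) (there x∈) (there y∈) (s≤s few)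
    (closed⇒safe S (c ∷ ks) (star-closed {S = S} sf (_ , _ , x≢y , cx , cy) ¬outside nbrs))
    (isolated-not-leaf {S = S ─ (c ∷ ks)} (─-isolated S (here refl)))

-- The star case: c has two neighbours x, y.  If c has at most three neighbours,
-- delete its whole star; otherwise delete only x and y, leaving c branching.
starCase : ∀ {n} {S : Graph n} → StarForest S → ∀ {c} → Branching S c → Step S
starCase {S = S} sf {c} br@(x , y , x≢y , cx , cy) with neighbourOutside? S c (x ∷ y ∷ [])
... | no ¬z = wholeStarStep sf x≢y cx cy (x ∷ y ∷ []) (here refl) (there (here refl))
                (s≤s (s≤s z≤n)) ¬z (cx ∷ cy ∷ [])
... | yes (z , cz , z∉) with neighbourOutside? S c (x ∷ y ∷ z ∷ [])
...   | no ¬w = wholeStarStep sf x≢y cx cy (x ∷ y ∷ z ∷ []) (here refl) (there (here refl))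
                  ≤-refl ¬w (cx ∷ cy ∷ cz ∷ [])
...   | yes (w , cw , w∉) =
  starStep sf x≢y cx cy leaves (here refl) (there (here refl)) (s≤s (s≤s z≤n))
    safe (branching-not-leaf {S = S ─ leaves} c-branching)
  where
  leaves : List (Fin _)
  leaves = x ∷ y ∷ []
  c∉ : c ∉ leaves
  c∉ (here c≡x)         = adj-irrefl S cx c≡x
  c∉ (there (here c≡y)) = adj-irrefl S cy c≡y
  w∉leaves : w ∉ leaves
  w∉leaves (here w≡x)         = w∉ (here w≡x)
  w∉leaves (there (here w≡y)) = w∉ (there (here w≡y))
  c-branching : Branching (S ─ leaves) c
  c-branching = z , w , (λ z≡w → w∉ (there (there (here (sym z≡w)))))
              , ─-keeps S c∉ z∉ cz , ─-keeps S c∉ w∉leaves cw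
  -- The deleted leaves are adjacent only to c, which stays branching.
  safe : SafeDeletion S leaves
  safe v u vu u∈ v∉ = subst (Branching (S ─ leaves)) (sym (v≡c u∈)) c-branching
    where
    v≡c : u ∈ leaves → v ≡ c
    v≡c (here refl)         = centre-leaf {S = S} sf br cx v (adj-sym S vu)
    v≡c (there (here refl)) = centre-leaf {S = S} sf br cy v (adj-sym S vu)

noBranching-only : ∀ {n} {S : Graph n} → ¬ (∃[ v ] Branching S v) →
                   ∀ {u v} → Adj S u v ≡ true → OnlyNeighbour S u v
noBranching-only ¬branching {u} {v} uv w uw =
  decidable-stable (w ≟ v) (λ w≢v → ¬branching (u , w , v , w≢v , uw , uv))

matchingCase : ∀ {n} {S : Graph n} → ¬ (∃[ v ] Branching S v) →
               ∀ {a b a' b'} → Adj S a b ≡ true → Adj S a' b' ≡ true → a' ∉ a ∷ b ∷ [] → Step S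
matchingCase {S = S} ¬branching {a} {b} {a'} {b'} ab a'b' a'∉ = record
  { deleted = deleted ; few = ≤-refl
  ; safe = closed⇒safe S deleted closed
  ; τ = τ ; τ-moves = τ-moves
  ; p = a ; q = b ; pq = ab
  ; τpτq = subst₂ (λ u v → Adj S u v ≡ true) (sym τa) (sym τb) a'b'
  ; τq≢q = λ b'≡b → b'≢b (trans (sym τb) b'≡b)
  ; τq≢p = λ b'≡a → b'≢a (trans (sym τb) b'≡a)
  ; p-notLeaf = isolated-not-leaf {S = S ─ deleted} (─-isolated S (here refl)) }
  where
  only : ∀ {u v} → Adj S u v ≡ true → OnlyNeighbour S u v
  only = noBranching-only {S = S} ¬branching
  a'≢a : a' ≢ a
  a'≢a = a'∉ ∘ here
  a'≢b : a' ≢ b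
  a'≢b = a'∉ ∘ there ∘ here
  -- b' = a or b' = b would give a or b a second neighbour a'.
  b'≢a : b' ≢ a
  b'≢a refl = a'≢b (only ab a' (adj-sym S a'b'))
  b'≢b : b' ≢ b
  b'≢b refl = a'≢a (only (adj-sym S ab) a' (adj-sym S a'b'))
  leaf : ∀ {v u} → Adj S v u ≡ true → Leaf S v
  leaf vu = _ , vu , only vu
  deleted : List (Fin _)
  deleted = a ∷ b ∷ a' ∷ b' ∷ []
  τ : Permutation′ _
  τ = transpose b b' ∘ₚ transpose a a'
  τa : τ ⟨$⟩ʳ a ≡ a'
  τa = trans (cong (transpose a a' ⟨$⟩ʳ_) (transpose-fix b b' a (adj-irrefl S ab) (b'≢a ∘ sym)))
             (transpose-left a a')
  τb : τ ⟨$⟩ʳ b ≡ b'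
  τb = trans (cong (transpose a a' ⟨$⟩ʳ_) (transpose-left b b'))
             (transpose-fix a a' b' b'≢a (adj-irrefl S a'b' ∘ sym))
  -- Each deleted vertex has its only neighbour among the deleted ones.
  closed : ∀ v u → Adj S v u ≡ true → u ∈ deleted → v ∈ deleted
  closed v u vu (here refl)                         = there (here (only ab v (adj-sym S vu)))
  closed v u vu (there (here refl))                 = here (only (adj-sym S ab) v (adj-sym S vu))
  closed v u vu (there (there (here refl)))         = there (there (there (here (only a'b' v (adj-sym S vu)))))
  closed v u vu (there (there (there (here refl)))) = there (there (here (only (adj-sym S a'b') v (adj-sym S vu))))
  τ-moves : ∀ v → τ ⟨$⟩ʳ v ≢ v → v ∈ deleted × Leaf S v
  τ-moves v moved with ∘ₚ-moves (transpose b b') (transpose a a') v moved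
  ... | inj₁ moved-b with transpose-moves b b' v moved-b
  ...   | inj₁ refl = there (here refl) , leaf (adj-sym S ab)
  ...   | inj₂ refl = there (there (there (here refl))) , leaf (adj-sym S a'b')
  τ-moves v moved | inj₂ moved-a with transpose-moves a a' v moved-a
  ...   | inj₁ refl = here refl , leaf ab
  ...   | inj₂ refl = there (there (here refl)) , leaf a'b'

step-or-base : ∀ {n} {S : Graph n} → StarForest S → Step S ⊎ Bound S
step-or-base {S = S} sf with branching? S
... | yes (c , br) = inj₁ (starCase sf br)
... | no ¬branching with edgeOutside? S []
...   | no ¬edge = inj₂ (base-bound S [] ¬edge z≤n)
...   | yes (a , b , ab , _) with edgeOutside? S (a ∷ b ∷ [])
...     | no ¬other = inj₂ (base-bound S (a ∷ b ∷ []) ¬other ≤-refl)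
...     | yes (a' , b' , a'b' , a'∉) = inj₁ (matchingCase ¬branching ab a'b' a'∉)

starForestBound : ∀ {n} (S : Graph n) → Acc _<_ (arcCount S) → StarForest S → Bound S
starForestBound S (acc smaller) sf with step-or-base sf
... | inj₂ bound = bound
... | inj₁ step  = step-bound (starForestBound (S ─ deleted) (smaller shrinks)
                                               (starForest-⊆ {S = S} {S ─ deleted} (─-⊆ S deleted) sf))
  where open Step step

-- Pass to a spanning star forest S, whose n vertices are all non-isolated.
proposition2p3 : ∀ (n : ℕ) (G : Graph n) → NoIsolated G →
                   ∃[ s ] (HasIsoPair G s × n ∸ 2 ≤ 4 * s)
proposition2p3 n G noIso with spanningStarForest G (<-wellFounded (arcCount G)) noIso
... | S , S⊆G , noIsoS , sfS with starForestBound S (<-wellFounded (arcCount S)) sfS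
... | s , pair , bound = s , toHasIsoPair S⊆G pair , n∸2≤4s
  where
  open ≤-Reasoning
  n∸2≤4s : n ∸ 2 ≤ 4 * s
  n∸2≤4s = begin
    n ∸ 2                ≡⟨ cong (_∸ 2) (nonIsolated-spanning S noIsoS) ⟨
    nonIsolated S ∸ 2    ≤⟨ ∸-monoˡ-≤ 2 bound ⟩
    4 * s + 2 ∸ 2        ≡⟨ m+n∸n≡m (4 * s) 2 ⟩
    4 * s                ∎
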